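{- Let $k$ be a positive integer, $G$ a graph and $e$ an edge of $G$. Then $\gamma_{P,k}(G)-1\le \gamma_{P,k}(G-e)\le \gamma_{P,k}(G)+1$. Moreover, if $\gamma_{P,k}(G-e)=\gamma_{P,k}(G)-1$ then $\mathrm{rad}_{P,k}(G)\le \mathrm{rad}_{P,k}(G-e)$, and if $\gamma_{P,k}(G-e)=\gamma_{P,k}(G)+1$ then $\mathrm{rad}_{P,k}(G-e)\le \mathrm{rad}_{P,k}(G)$.
   Context: All graphs are finite and simple. $G-e$ is obtained from $G$ by deleting the edge $e$. $N_G[v]$ is the closed neighbourhood of $v$ and $N_G[S]=\bigcup_{v\in S}N_G[v]$. For $S\subseteq V(G)$, define $\mathcal{P}^{0}_{G,k}(S)=N_G[S]$ and $\mathcal{P}^{t+1}_{G,k}(S)=\bigcup\{N_G[u] : u\in \mathcal{P}^{t}_{G,k}(S),\ |N_G[u]\setminus \mathcal{P}^{t}_{G,k}(S)|\le k\}$; these sets increase and stabilize to $\mathcal{P}^{\infty}_{G,k}(S)$. $S$ is a $k$-power dominating set ($k$-PDS) if $\mathcal{P}^{\infty}_{G,k}(S)=V(G)$; $\gamma_{P,k}(G)$ is the minimum size of a $k$-PDS. For a $k$-PDS $S$, $\mathrm{rad}_{P,k}(G,S)=1+\min\{t:\mathcal{P}^{t}_{G,k}(S)=V(G)\}$, and $\mathrm{rad}_{P,k}(G)$ is the minimum of $\mathrm{rad}_{P,k}(G,S)$ over all $k$-PDS $S$ of size $\gamma_{P,k}(G)$. -}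

module Defs where

open import Data.Bool using (Bool; true; false; _∧_; _∨_; not; T)
open import Data.Nat using (ℕ; zero; suc; _≤_; _<_; _≤ᵇ_)
open import Data.Fin using (Fin; _≟_)
open import Data.Fin.Subset using (Subset; ⊤; _─_; ∣_∣)
open import Data.Vec using (tabulate; lookup)
open import Data.List using (allFin)
open import Data.Bool.ListAction using (any)
open import Data.Product using (Σ; ∃; _×_; _,_)
open import Relation.Nullary using (¬_)
open import Relation.Nullary.Decidable using (⌊_⌋)
open import Relation.Binary.PropositionalEquality using (_≡_; refl; sym; trans; cong)

record Graph (n : ℕ) : Set where
  field
    adj     : Fin n → Fin n → Bool
    adj-sym : ∀ x y → adj x y ≡ adj y x
    adj-irr : ∀ x → adj x x ≡ false
open Graph public

orderedPair : {n : ℕ} → Fin n → Fin n → Fin n → Fin n → Bool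
orderedPair u v x y = ⌊ x ≟ u ⌋ ∧ ⌊ y ≟ v ⌋

samePair : {n : ℕ} → Fin n → Fin n → Fin n → Fin n → Bool
samePair u v x y = orderedPair u v x y ∨ orderedPair u v y x

private
  ∨-comm : ∀ a b → (a ∨ b) ≡ (b ∨ a)
  ∨-comm false false = refl
  ∨-comm false true = refl
  ∨-comm true false = refl
  ∨-comm true true = refl

-- An edge of G: an (ordered representative of an) adjacent pair.
Edge : {n : ℕ} → Graph n → Set
Edge {n} G = Σ (Fin n) λ u → Σ (Fin n) λ v → adj G u v ≡ true

deleteEdge : {n : ℕ} (G : Graph n) → Edge G → Graph n
deleteEdge G (u , v , _) = record
  { adj     = λ x y → adj G x y ∧ not (samePair u v x y)
  ; adj-sym = λ x y → trans (cong (_∧ not (samePair u v x y)) (adj-sym G x y))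
                            (cong (λ b → adj G y x ∧ not b) (∨-comm (orderedPair u v x y) (orderedPair u v y x)))
  ; adj-irr = λ x → cong (_∧ not (samePair u v x x)) (adj-irr G x)
  }

N[_] : {n : ℕ} → Graph n → Fin n → Subset n
N[_] G v = tabulate λ w → ⌊ v ≟ w ⌋ ∨ adj G v w

N[_]S : {n : ℕ} → Graph n → Subset n → Subset n
N[_]S {n} G S = tabulate λ w → any (λ v → lookup S v ∧ lookup (N[ G ] v) w) (allFin n)

step : {n : ℕ} → Graph n → ℕ → Subset n → Subset n
step {n} G k P = tabulate λ w →
  any (λ u → lookup P u ∧ (∣ N[ G ] u ─ P ∣ ≤ᵇ k) ∧ lookup (N[ G ] u) w) (allFin n)

P : {n : ℕ} → Graph n → ℕ → Subset n → ℕ → Subset n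
P G k S zero    = N[ G ]S S
P G k S (suc t) = step G k (P G k S t)

-- S is a k-power dominating set: the increasing chain P^t reaches V(G)
-- (equivalently its union / stable value P^∞ is V(G)).
IsPDS : {n : ℕ} → Graph n → ℕ → Subset n → Set
IsPDS G k S = ∃ λ t → P G k S t ≡ ⊤

IsPowerDomNum : {n : ℕ} → Graph n → ℕ → ℕ → Set
IsPowerDomNum {n} G k g =
  (Σ (Subset n) λ S → IsPDS G k S × ∣ S ∣ ≡ g)
  × (∀ (S : Subset n) → IsPDS G k S → g ≤ ∣ S ∣)

IsRadS : {n : ℕ} → Graph n → ℕ → Subset n → ℕ → Set
IsRadS G k S r = Σ ℕ λ t → (r ≡ suc t) × (P G k S t ≡ ⊤)
                          × (∀ t' → t' < t → ¬ (P G k S t' ≡ ⊤))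

IsRad : {n : ℕ} → Graph n → ℕ → ℕ → Set
IsRad {n} G k r = Σ ℕ λ g → IsPowerDomNum G k g ×
  ( (Σ (Subset n) λ S → IsPDS G k S × ∣ S ∣ ≡ g × IsRadS G k S r)
  × (∀ (S : Subset n) (r' : ℕ) → IsPDS G k S → ∣ S ∣ ≡ g → IsRadS G k S r' → r ≤ r') )

-- If uv is deleted, adding u to a k-PDS of G − uv gives a k-PDS of G observing, at every
-- step, at least what the old set observed: u and v are observed from the start, so the edge
-- never counts against a forcing vertex. Conversely, adding to a k-PDS S of G an endpoint b
-- of uv whose partner a is observed no later than b (and lies in S if b does) gives a k-PDS
-- of G − uv: a force of a by b along the edge is then unnecessary, and b itself is observed
-- from the start. Since both constructions never slow observation down, when γ changes by
-- one the new minimum sets realise at most the radius of the old ones.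
module Submission where

open import Defs
open import Data.Nat using (ℕ; suc; _≤_; _+_)
open import Data.Product using (_×_)
open import Relation.Binary.PropositionalEquality using (_≡_)

open import Data.Bool using (Bool; true; false; T; _∨_)
open import Data.Bool.Properties using (T-≡; T-∧; T-∨; T-not-≡)
import Data.Bool.Properties as Bool
open import Data.Bool.ListAction using (any)
open import Data.Empty using (⊥-elim)
open import Data.Fin using (Fin; zero; suc; _≟_)
open import Data.Fin.Subset using (Subset; ⊤; ⊥; _∈_; _∉_; _⊆_; _∪_; _─_; ⁅_⁆; ∣_∣; inside; outside)
open import Data.Fin.Subset.Properties
  using (_∈?_; ∈⊤; ⊆⊤; ⊆-antisym; x∈⁅x⁆; ∪-identityʳ; ∣p∣≤∣x∷p∣; p⊆q⇒∣p∣≤∣q∣; ∣⊥∣≡0;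
         p⊆p∪q; q⊆p∪q; p─q⊆p; x∈p∧x∉q⇒x∈p─q)
open import Data.List using (allFin)
import Data.List.Relation.Unary.Any as Any
open import Data.List.Relation.Unary.Any.Properties
  using (any⁺; any⁻) renaming (tabulate⁺ to Any-tabulate⁺)
open import Data.Nat using (zero; _<_; _≤?_; _≤′_; ≤′-refl; ≤′-step; z≤n; s≤s)
open import Data.Nat.Properties
  using (≤-reflexive; ≤-trans; ≤-antisym; module ≤-Reasoning; +-comm; ≤⇒≤′; ≰⇒>; ≤ᵇ⇒≤; ≤⇒≤ᵇ)
open import Data.Product using (Σ-syntax; ∃; _,_; proj₁; proj₂)
import Data.Product as Product
open import Data.Sum using (_⊎_; inj₁; inj₂; [_,_]′)
import Data.Sum as Sum
open import Data.Vec using (_∷_; lookup; tabulate; here; there)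
open import Data.Vec.Properties using (lookup∘tabulate; []=⇒lookup; lookup⇒[]=; ≡-dec)
open import Function using (_∘_; id; const; Equivalence)
open import Relation.Binary.PropositionalEquality using (refl; sym; trans; cong; subst)
open import Relation.Nullary using (¬_; Dec; yes; no)
open import Relation.Nullary.Decidable using (⌊_⌋; toWitness; fromWitness; _⊎-dec_)
open import Relation.Unary using (Decidable)

open Equivalence using (to; from)

private
  variable
    n k : ℕ
    x y : Fin n
    p q : Subset n

∈⇒T : x ∈ p → T (lookup p x)
∈⇒T x∈p = from T-≡ ([]=⇒lookup x∈p)

T⇒∈ : T (lookup p x) → x ∈ p
T⇒∈ {p = p} {x} t = lookup⇒[]= x p (to T-≡ t)

∈-tabulate⁺ : (f : Fin n → Bool) → T (f x) → x ∈ tabulate f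
∈-tabulate⁺ {x = x} f t = T⇒∈ (subst T (sym (lookup∘tabulate f x)) t)

∈-tabulate⁻ : (f : Fin n → Bool) → x ∈ tabulate f → T (f x)
∈-tabulate⁻ {x = x} f m = subst T (lookup∘tabulate f x) (∈⇒T m)

x∈p─q⇒x∉q : x ∈ p ─ q → x ∉ q
x∈p─q⇒x∉q {p = _ ∷ _} {q = outside ∷ _} here      ()
x∈p─q⇒x∉q {p = _ ∷ _} {q = _       ∷ _} (there m) (there m′) = x∈p─q⇒x∉q m m′

∣─∣-mono : ∀ {a b c d : Subset n} → (∀ {x} → x ∈ a → x ∉ b → x ∈ c × x ∉ d) → ∣ a ─ b ∣ ≤ ∣ c ─ d ∣
∣─∣-mono {a = a} {b} h = p⊆q⇒∣p∣≤∣q∣ λ m →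
  let (x∈c , x∉d) = h (p─q⊆p a b m) (x∈p─q⇒x∉q m) in x∈p∧x∉q⇒x∈p─q x∈c x∉d

p⊆q⇒∣p─q∣≤k : p ⊆ q → ∣ p ─ q ∣ ≤ k
p⊆q⇒∣p─q∣≤k {n} {p} {q} p⊆q =
  ≤-trans (p⊆q⇒∣p∣≤∣q∣ {p = p ─ q} {q = ⊥} (λ m → ⊥-elim (x∈p─q⇒x∉q m (p⊆q (p─q⊆p p q m)))))
          (subst (_≤ _) (sym (∣⊥∣≡0 n)) z≤n)

∣p∪⁅x⁆∣≤1+∣p∣ : ∀ (p : Subset n) x → ∣ p ∪ ⁅ x ⁆ ∣ ≤ suc ∣ p ∣
∣p∪⁅x⁆∣≤1+∣p∣ (s       ∷ p) zero    rewrite ∪-identityʳ p | Bool.∨-zeroʳ s = s≤s (∣p∣≤∣x∷p∣ s p)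
∣p∪⁅x⁆∣≤1+∣p∣ (outside ∷ p) (suc x) = ∣p∪⁅x⁆∣≤1+∣p∣ p x
∣p∪⁅x⁆∣≤1+∣p∣ (inside  ∷ p) (suc x) = s≤s (∣p∪⁅x⁆∣≤1+∣p∣ p x)

least-witness : ∀ {Q : ℕ → Set} → Decidable Q → ∀ {t} → Q t →
        Σ[ m ∈ ℕ ] m ≤ t × Q m × (∀ s → s < m → ¬ Q s)
least-witness Q? {zero} q = 0 , z≤n , q , λ _ ()
least-witness Q? {suc t} q with Q? 0
... | yes q₀ = 0 , z≤n , q₀ , λ _ ()
... | no ¬q₀ with least-witness (Q? ∘ suc) q
...   | m , m≤t , qm , below = suc m , s≤s m≤t , qm , λ where
  zero    _         → ¬q₀
  (suc s) (s≤s s<m) → below s s<m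

module _ (G : Graph n) where

  ∈N[]⁺ : ∀ {v w} → v ≡ w ⊎ T (adj G v w) → w ∈ N[ G ] v
  ∈N[]⁺ {v} = ∈-tabulate⁺ (λ w → ⌊ v ≟ w ⌋ ∨ adj G v w) ∘ from T-∨ ∘ Sum.map₁ fromWitness

  ∈N[]⁻ : ∀ {v w} → w ∈ N[ G ] v → v ≡ w ⊎ T (adj G v w)
  ∈N[]⁻ {v} = Sum.map₁ toWitness ∘ to T-∨ ∘ ∈-tabulate⁻ (λ w → ⌊ v ≟ w ⌋ ∨ adj G v w)

  v∈N[v] : ∀ v → v ∈ N[ G ] v
  v∈N[v] v = ∈N[]⁺ (inj₁ refl)

  ∈N[]S⁺ : ∀ {S s w} → s ∈ S → w ∈ N[ G ] s → w ∈ N[ G ]S S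
  ∈N[]S⁺ {s = s} s∈S w∈N = ∈-tabulate⁺ _ (any⁺ _ (Any-tabulate⁺ s (from T-∧ (∈⇒T s∈S , ∈⇒T w∈N))))

  ∈N[]S⁻ : ∀ S {w} → w ∈ N[ G ]S S → ∃ λ s → s ∈ S × w ∈ N[ G ] s
  ∈N[]S⁻ S m with Any.satisfied (any⁻ _ (allFin _) (∈-tabulate⁻ _ m))
  ... | s , t = let (s∈S , w∈N) = to T-∧ t in s , T⇒∈ s∈S , T⇒∈ w∈N

module _ (G : Graph n) (k : ℕ) where

  ∈step⁺ : ∀ {Q u w} → u ∈ Q → ∣ N[ G ] u ─ Q ∣ ≤ k → w ∈ N[ G ] u → w ∈ step G k Q
  ∈step⁺ {u = u} u∈Q c w∈N =
    ∈-tabulate⁺ _ (any⁺ _ (Any-tabulate⁺ u (from T-∧ (∈⇒T u∈Q , from T-∧ (≤⇒≤ᵇ c , ∈⇒T w∈N)))))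

  ∈step⁻ : ∀ Q {w} → w ∈ step G k Q → ∃ λ u → u ∈ Q × ∣ N[ G ] u ─ Q ∣ ≤ k × w ∈ N[ G ] u
  ∈step⁻ Q m with Any.satisfied (any⁻ _ (allFin _) (∈-tabulate⁻ _ m))
  ... | u , t = let (u∈Q , rest) = to T-∧ t ; (c , w∈N) = to T-∧ rest in
                u , T⇒∈ u∈Q , ≤ᵇ⇒≤ _ k c , T⇒∈ w∈N

  N[]⊆step : ∀ {Q u} → u ∈ Q → N[ G ] u ⊆ Q → N[ G ] u ⊆ step G k Q
  N[]⊆step u∈Q N⊆Q = ∈step⁺ u∈Q (p⊆q⇒∣p─q∣≤k N⊆Q)

  P-⊆-suc : ∀ S t → P G k S t ⊆ P G k S (suc t)
  P-⊆-suc S zero m with ∈N[]S⁻ G S m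
  ... | s , s∈S , x∈N = N[]⊆step (∈N[]S⁺ G s∈S (v∈N[v] G s)) (∈N[]S⁺ G s∈S) x∈N
  P-⊆-suc S (suc t) m with ∈step⁻ (P G k S t) m
  ... | u , u∈P , c , x∈N = N[]⊆step (P-⊆-suc S t u∈P) (∈step⁺ u∈P c) x∈N

  P-mono : ∀ S {s t} → s ≤ t → P G k S s ⊆ P G k S t
  P-mono S = mono′ ∘ ≤⇒≤′
    where
    mono′ : ∀ {s t} → s ≤′ t → P G k S s ⊆ P G k S t
    mono′ ≤′-refl           = id
    mono′ (≤′-step {t} s≤t) = P-⊆-suc S t ∘ mono′ s≤t

  S⊆P : ∀ S t → S ⊆ P G k S t
  S⊆P S t s∈S = P-mono S {t = t} z≤n (∈N[]S⁺ G s∈S (v∈N[v] G _))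

record IsEdgeDeletion (G H : Graph n) (a b : Fin n) : Set where
  field
    N[]-⊆       : ∀ w → N[ H ] w ⊆ N[ G ] w
    N[]-missing : ∀ {w y} → y ∈ N[ G ] w → y ∈ N[ H ] w ⊎ (w ≡ a × y ≡ b) ⊎ (w ≡ b × y ≡ a)

isEdgeDeletion-sym : ∀ {G H : Graph n} {a b} → IsEdgeDeletion G H a b → IsEdgeDeletion G H b a
isEdgeDeletion-sym D = record
  { N[]-⊆       = N[]-⊆
  ; N[]-missing = Sum.map₂ Sum.swap ∘ N[]-missing
  } where open IsEdgeDeletion D

orderedPair-sound : ∀ {u v x y : Fin n} → T (orderedPair u v x y) → x ≡ u × y ≡ v
orderedPair-sound {u = u} {v} {x} {y} t with x ≟ u | y ≟ v
... | yes x≡u | yes y≡v = x≡u , y≡v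
orderedPair-sound () | yes _ | no _
orderedPair-sound () | no _  | _

samePair-sound : ∀ {u v x y : Fin n} → T (samePair u v x y) → (x ≡ u × y ≡ v) ⊎ (x ≡ v × y ≡ u)
samePair-sound = Sum.map orderedPair-sound (Product.swap ∘ orderedPair-sound) ∘ to T-∨

deleteEdge-isEdgeDeletion : (G : Graph n) {u v : Fin n} (uv : adj G u v ≡ true) →
                            IsEdgeDeletion G (deleteEdge G (u , v , uv)) u v
deleteEdge-isEdgeDeletion G {u} {v} uv = record
  { N[]-⊆       = λ w → ∈N[]⁺ G ∘ Sum.map₂ (proj₁ ∘ to T-∧) ∘ ∈N[]⁻ H
  ; N[]-missing = missing ∘ ∈N[]⁻ G
  }
  where
  H = deleteEdge G (u , v , uv)
  missing : ∀ {w y} → w ≡ y ⊎ T (adj G w y) → y ∈ N[ H ] w ⊎ (w ≡ u × y ≡ v) ⊎ (w ≡ v × y ≡ u)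
  missing (inj₁ w≡y) = inj₁ (∈N[]⁺ H (inj₁ w≡y))
  missing {w} {y} (inj₂ w~y) with samePair u v w y in eq
  ... | true  = inj₂ (samePair-sound (from T-≡ eq))
  ... | false = inj₁ (∈N[]⁺ H (inj₂ (from T-∧ (w~y , from T-not-≡ eq))))

EntersNoLater : (ℕ → Subset n) → Fin n → Fin n → Set
EntersNoLater X a b = ∀ t → b ∈ X t → a ∈ X t

module _ (X : ℕ → Subset n) (X-mono : ∀ {s t} → s ≤ t → X s ⊆ X t) where

  first-entersNoLater : ∀ {x y t*} → x ∈ X t* → (∀ s → s < t* → ¬ (x ∈ X s ⊎ y ∈ X s)) →
                        EntersNoLater X x y
  first-entersNoLater {t* = t*} x∈X* before t y∈X with t* ≤? t
  ... | yes t*≤t = X-mono t*≤t x∈X*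
  ... | no  t*≰t = ⊥-elim (before t (≰⇒> t*≰t) (inj₂ y∈X))

  -- Compare a and b at the first time either of them has entered the chain.
  entersNoLater-total : ∀ {a b t₀} → a ∈ X t₀ → EntersNoLater X a b ⊎ EntersNoLater X b a
  entersNoLater-total {a} {b} a∈X with least-witness (λ t → (a ∈? X t) ⊎-dec (b ∈? X t)) (inj₁ a∈X)
  ... | _ , _ , inj₁ a∈X* , before = inj₁ (first-entersNoLater a∈X* before)
  ... | _ , _ , inj₂ b∈X* , before =
    inj₂ (first-entersNoLater b∈X* (λ s s<t* → before s s<t* ∘ Sum.swap))

OneMoreSimulation : (G₁ G₂ : Graph n) → ℕ → Subset n → Set
OneMoreSimulation {n} G₁ G₂ k S =
  Σ[ T ∈ Subset n ] ∣ T ∣ ≤ suc ∣ S ∣ × (∀ t → P G₁ k S t ⊆ P G₂ k T t)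

PDSOneMoreSimulation : (G₁ G₂ : Graph n) → ℕ → Set
PDSOneMoreSimulation G₁ G₂ k = ∀ S → IsPDS G₁ k S → OneMoreSimulation G₁ G₂ k S

module _ {G H : Graph n} {a b : Fin n} (D : IsEdgeDeletion G H a b) (k : ℕ) where
  open IsEdgeDeletion D

  P-delete⊆P-∪⁅a⁆ : b ∈ N[ G ] a → ∀ S t → P H k S t ⊆ P G k (S ∪ ⁅ a ⁆) t
  P-delete⊆P-∪⁅a⁆ a~b S = go
    where
    S′ = S ∪ ⁅ a ⁆

    a∈S′ : a ∈ S′
    a∈S′ = q⊆p∪q S ⁅ a ⁆ (x∈⁅x⁆ a)

    go : ∀ t → P H k S t ⊆ P G k S′ t
    go zero m with ∈N[]S⁻ H S m
    ... | s , s∈S , x∈N = ∈N[]S⁺ G (p⊆p∪q ⁅ a ⁆ s∈S) (N[]-⊆ s x∈N)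
    go (suc t) m with ∈step⁻ H k (P H k S t) m
    ... | w , w∈P , c , x∈N = ∈step⁺ G k (go t w∈P) (≤-trans (∣─∣-mono missing) c) (N[]-⊆ w x∈N)
      where
      -- a and b are observed from the start, so the deleted edge never hinders a forcing step.
      missing : ∀ {y} → y ∈ N[ G ] w → y ∉ P G k S′ t → y ∈ N[ H ] w × y ∉ P H k S t
      missing y∈N y∉P with N[]-missing y∈N
      ... | inj₁ y∈N′             = y∈N′ , y∉P ∘ go t
      ... | inj₂ (inj₁ (_ , refl)) = ⊥-elim (y∉P (P-mono G k S′ {t = t} z≤n (∈N[]S⁺ G a∈S′ a~b)))
      ... | inj₂ (inj₂ (_ , refl)) = ⊥-elim (y∉P (S⊆P G k S′ t a∈S′))

  P⊆P-delete-∪⁅b⁆ : ∀ S → EntersNoLater (P G k S) a b → (b ∈ S → a ∈ S) →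
                    ∀ t → P G k S t ⊆ P H k (S ∪ ⁅ b ⁆) t
  P⊆P-delete-∪⁅b⁆ S a≼b b∈S⇒a∈S = go
    where
    S′ = S ∪ ⁅ b ⁆

    b∈P : ∀ t → b ∈ P H k S′ t
    b∈P t = S⊆P H k S′ t (q⊆p∪q S ⁅ b ⁆ (x∈⁅x⁆ b))

    go : ∀ t → P G k S t ⊆ P H k S′ t
    go zero m with ∈N[]S⁻ G S m
    ... | s , s∈S , x∈N with N[]-missing x∈N
    ...   | inj₁ x∈N′                = ∈N[]S⁺ H (p⊆p∪q ⁅ b ⁆ s∈S) x∈N′
    ...   | inj₂ (inj₁ (_ , refl))    = b∈P zero
    ...   | inj₂ (inj₂ (refl , refl)) = S⊆P H k S′ zero (p⊆p∪q ⁅ b ⁆ (b∈S⇒a∈S s∈S))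
    go (suc t) m with ∈step⁻ G k (P G k S t) m
    ... | w , w∈P , c , x∈N with N[]-missing x∈N
    ...   | inj₁ x∈N′ =
      ∈step⁺ H k (go t w∈P) (≤-trans (∣─∣-mono λ y∈N y∉P → N[]-⊆ w y∈N , y∉P ∘ go t) c) x∈N′
    ...   | inj₂ (inj₁ (_ , refl))    = b∈P (suc t)
    ...   | inj₂ (inj₂ (refl , refl)) = P-⊆-suc H k S′ t (go t (a≼b t w∈P))

  simulation-∪⁅b⁆ : ∀ S → EntersNoLater (P G k S) a b → (b ∈ S → a ∈ S) → OneMoreSimulation G H k S
  simulation-∪⁅b⁆ S a≼b b∈S⇒a∈S = S ∪ ⁅ b ⁆ , ∣p∪⁅x⁆∣≤1+∣p∣ S b , P⊆P-delete-∪⁅b⁆ S a≼b b∈S⇒a∈S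

deleteEdge-simulatedBy : (G : Graph n) (e : Edge G) (k : ℕ) → PDSOneMoreSimulation (deleteEdge G e) G k
deleteEdge-simulatedBy G (u , v , uv) k S _ =
  S ∪ ⁅ u ⁆ , ∣p∪⁅x⁆∣≤1+∣p∣ S u ,
  P-delete⊆P-∪⁅a⁆ (deleteEdge-isEdgeDeletion G uv) k (∈N[]⁺ G (inj₂ (from T-≡ uv))) S

-- A vertex of S is observed from the start; otherwise add the endpoint observed last.
simulatedBy-deleteEdge : (G : Graph n) (e : Edge G) (k : ℕ) → PDSOneMoreSimulation G (deleteEdge G e) k
simulatedBy-deleteEdge G e@(u , v , uv) k S (t₀ , full) = choose (u ∈? S) (v ∈? S)
  where
  D  = deleteEdge-isEdgeDeletion G uv
  D′ = isEdgeDeletion-sym D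

  observedFirst : ∀ {x y} → x ∈ S → EntersNoLater (P G k S) x y
  observedFirst x∈S t _ = S⊆P G k S t x∈S

  choose : Dec (u ∈ S) → Dec (v ∈ S) → OneMoreSimulation G (deleteEdge G e) k S
  choose (yes u∈S) _         = simulation-∪⁅b⁆ D  k S (observedFirst u∈S) (const u∈S)
  choose (no _)    (yes v∈S) = simulation-∪⁅b⁆ D′ k S (observedFirst v∈S) (const v∈S)
  choose (no u∉S)  (no v∉S)  =
    [ (λ u≼v → simulation-∪⁅b⁆ D  k S u≼v (⊥-elim ∘ v∉S))
    , (λ v≼u → simulation-∪⁅b⁆ D′ k S v≼u (⊥-elim ∘ u∉S)) ]′
    (entersNoLater-total (P G k S) (P-mono G k S) {t₀ = t₀} (subst (u ∈_) (sym full) ∈⊤))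

isPowerDomNum-unique : ∀ {G : Graph n} {g g′} → IsPowerDomNum G k g → IsPowerDomNum G k g′ → g ≡ g′
isPowerDomNum-unique ((S , pds , refl) , min) ((S′ , pds′ , refl) , min′) =
  ≤-antisym (min S′ pds′) (min′ S pds)

P-full-transfer : ∀ {G₁ G₂ : Graph n} {S T} → (∀ t → P G₁ k S t ⊆ P G₂ k T t) →
                  ∀ t → P G₁ k S t ≡ ⊤ → P G₂ k T t ≡ ⊤
P-full-transfer P⊆P t full = ⊆-antisym ⊆⊤ λ {x} _ → P⊆P t (subst (x ∈_) (sym full) ∈⊤)

isRadS-exists : ∀ (G : Graph n) S {t} → P G k S t ≡ ⊤ → Σ[ r ∈ ℕ ] IsRadS G k S r × r ≤ suc t
isRadS-exists {k = k} G S full with least-witness (λ t → ≡-dec Bool._≟_ (P G k S t) ⊤) full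
... | m , m≤t , full′ , before = suc m , (m , refl , full′ , before) , s≤s m≤t

powerDomNum-≤-+1 : ∀ {G₁ G₂ : Graph n} {g₁ g₂} → PDSOneMoreSimulation G₁ G₂ k →
                   IsPowerDomNum G₁ k g₁ → IsPowerDomNum G₂ k g₂ → g₂ ≤ g₁ + 1
powerDomNum-≤-+1 {g₁ = g₁} sim ((S , pds@(t , full) , refl) , _) (_ , min₂) with sim S pds
... | T , ∣T∣≤ , P⊆P =
  ≤-trans (min₂ T (t , P-full-transfer P⊆P t full)) (≤-trans ∣T∣≤ (≤-reflexive (+-comm 1 g₁)))

rad-≤ : ∀ {G₁ G₂ : Graph n} {g₁ g₂ r₁ r₂} → PDSOneMoreSimulation G₁ G₂ k →
        IsPowerDomNum G₁ k g₁ → IsPowerDomNum G₂ k g₂ → g₂ ≡ suc g₁ →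
        IsRad G₁ k r₁ → IsRad G₂ k r₂ → r₂ ≤ r₁
rad-≤ {k = k} {G₂ = G₂} {g₁} {g₂} sim γ₁ γ₂ g₂≡1+g₁
      (_ , γ₁′ , (S , pds , ∣S∣≡ , (t , refl , full , _)) , _) (g₂′ , γ₂′ , _ , min₂)
  with sim S pds
... | T , ∣T∣≤ , P⊆P with isRadS-exists G₂ T (P-full-transfer P⊆P t full)
... | r , radS , r≤1+t = ≤-trans (min₂ T r pdsT ∣T∣≡ radS) r≤1+t
  where
  pdsT : IsPDS G₂ k T
  pdsT = t , P-full-transfer P⊆P t full

  ∣T∣≡ : ∣ T ∣ ≡ g₂′
  ∣T∣≡ = ≤-antisym
    (begin
      ∣ T ∣    ≤⟨ ∣T∣≤ ⟩
      suc ∣ S ∣ ≡⟨ cong suc (trans ∣S∣≡ (isPowerDomNum-unique γ₁′ γ₁)) ⟩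
      suc g₁   ≡⟨ sym g₂≡1+g₁ ⟩
      g₂       ≡⟨ isPowerDomNum-unique γ₂ γ₂′ ⟩
      g₂′      ∎)
    (proj₂ γ₂′ T pdsT)
    where open ≤-Reasoning

theorem3 : ∀ {n : ℕ} (k : ℕ) → 1 ≤ k → (G : Graph n) (e : Edge G) →
    ∀ (g g' : ℕ) → IsPowerDomNum G k g → IsPowerDomNum (deleteEdge G e) k g' →
    (g ≤ g' + 1 × g' ≤ g + 1)
    × (suc g' ≡ g → ∀ (r r' : ℕ) → IsRad G k r → IsRad (deleteEdge G e) k r' → r ≤ r')
    × (g' ≡ suc g → ∀ (r r' : ℕ) → IsRad G k r → IsRad (deleteEdge G e) k r' → r' ≤ r)
-- The argument works for every k, including k = 0.
theorem3 k _ G e g g' γG γH =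
  (powerDomNum-≤-+1 H⇝G γH γG , powerDomNum-≤-+1 G⇝H γG γH) ,
  (λ 1+g'≡g _ _ radG radH → rad-≤ H⇝G γH γG (sym 1+g'≡g) radH radG) ,
  (λ g'≡1+g _ _ radG radH → rad-≤ G⇝H γG γH g'≡1+g radG radH)
  where
  H⇝G = deleteEdge-simulatedBy G e k
  G⇝H = simulatedBy-deleteEdge G e k
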